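{- Let $q$ be a prime power and let $a,b$ be integers with $a\geq 2$ and $b\geq0$. Then \[ \varphi^{ - }_{b+1,b+a}(q)\geq q^{ab+\binom{a+1}{2}}\left(1+(-1)^{b}q^{ -b-1}-(-1)^{b}q^{ -b-2}-q^{ -b-3}-q^{ -2b-3}\right). \]
   Context: For integers $b\ge a\ge0$, $\varphi^{ - }_{a,b}(q)=\prod_{k=a}^{b}(q^k-(-1)^k)$. -}

module Defs where

open import Data.Nat as ℕ using (ℕ; suc; _∸_; _≤_; NonZero)
open import Data.Nat.Properties using (m^n≢0)
open import Data.Nat.Primality using (Prime)
open import Data.Integer as ℤ using (ℤ; +_; -_)
open import Data.Rational as ℚ using (ℚ)
open import Data.List using (List; map; upTo; foldr)
open import Data.Product using (∃-syntax; _×_)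
open import Relation.Binary.PropositionalEquality using (_≡_)

IsPrimePower : ℕ → Set
IsPrimePower q = ∃[ p ] ∃[ k ] (Prime p × 1 ≤ k × q ≡ p ℕ.^ k)

negOnePow : ℕ → ℤ
negOnePow k = (ℤ.- ℤ.1ℤ) ℤ.^ k

range : ℕ → ℕ → List ℕ
range a b = map (a ℕ.+_) (upTo (suc b ∸ a))

φ⁻ : ℕ → ℕ → ℕ → ℤ
φ⁻ a b q = foldr (λ k acc → ((+ (q ℕ.^ k)) ℤ.- negOnePow k) ℤ.* acc) ℤ.1ℤ (range a b)

qpow : ℕ → ℕ → ℚ
qpow q k = (+ (q ℕ.^ k)) ℚ./ 1

qinv : (q k : ℕ) → .{{NonZero q}} → ℚ
qinv q k = ℚ._/_ (+ 1) (q ℕ.^ k) {{m^n≢0 q k}}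

sgn : ℕ → ℚ
sgn k = negOnePow k ℚ./ 1

-- With f k = q^k − (−1)^k, the left-hand side has exponent (b+1) + ⋯ + (b+a); multiplying
-- out the bracket against q^((b+1)+(b+2)) and using ((−1)^b)² = 1 turns it into the integer
-- (f (b+1) · f (b+2) − q^b) · q^M with M = (b+3) + ⋯ + (b+a), so it suffices to bound the
-- remaining product f (b+3) ⋯ f (b+a) from below by q^M. For odd c one has
-- f c · f (c+1) = (q^c + 1)(q^(c+1) − 1) ≥ q^c · q^(c+1), so a product of factors starting at an
-- odd index dominates the corresponding power of q. If b is even, b+3 is odd and we are done.
-- If b is odd, the first remaining factor q^(b+3) − 1 falls short of q^(b+3); the loss is
-- recovered from f (b+1) · f (b+2) = (q^(b+1) − 1)(q^(b+2) + 1) ≤ q^(b+3) · q^b.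

module Submission where

open import Defs
open import Data.Nat as ℕ using (ℕ; zero; suc; _≤_; z≤n; s≤s; NonZero)
import Data.Nat.Properties as ℕP
open import Data.Nat.Combinatorics using (_C_; nC1≡n; nCk+nC[k+1]≡[n+1]C[k+1])
open import Data.Nat.Primality using (prime⇒nonTrivial; prime⇒nonZero)
import Data.Nat.Tactic.RingSolver as ℕSolver
open import Data.Integer as ℤ using (ℤ; +_; +≤+; 0ℤ; 1ℤ; -1ℤ; nonNegative)
import Data.Integer.Properties as ℤP
open import Data.Integer.Tactic.RingSolver using (solve-∀)
open import Data.Rational as ℚ using (ℚ; 1ℚ)
import Data.Rational.Properties as ℚP
open import Data.Rational.Unnormalised as ℚᵘ using (mkℚᵘ; *≡*; *≤*)
import Data.Rational.Unnormalised.Properties as ℚᵘP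
open import Data.Rational.Solver using (module +-*-Solver)
open import Data.List using (foldr; applyUpTo; _∷_; [])
open import Data.List.Properties using (map-applyUpTo)
open import Data.Product using (_,_)
open import Data.Sum using (_⊎_; inj₁; inj₂)
open import Relation.Binary.PropositionalEquality
  using (_≡_; refl; sym; trans; cong; cong₂; subst; subst₂; module ≡-Reasoning)

negOnePow-suc : ∀ k → negOnePow (suc k) ≡ ℤ.- negOnePow k
negOnePow-suc k = ℤP.-1*i≡-i (negOnePow k)

negOnePow-suc-suc : ∀ k → negOnePow (suc (suc k)) ≡ negOnePow k
negOnePow-suc-suc k = trans (negOnePow-suc (suc k))
  (trans (cong ℤ.-_ (negOnePow-suc k)) (ℤP.neg-involutive (negOnePow k)))

Even Odd : ℕ → Set
Even k = negOnePow k ≡ 1ℤ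
Odd  k = negOnePow k ≡ -1ℤ

even⇒odd-suc : ∀ k → Even k → Odd (suc k)
even⇒odd-suc k e = trans (negOnePow-suc k) (cong ℤ.-_ e)

odd⇒even-suc : ∀ k → Odd k → Even (suc k)
odd⇒even-suc k o = trans (negOnePow-suc k) (cong ℤ.-_ o)

even⊎odd : ∀ k → Even k ⊎ Odd k
even⊎odd zero    = inj₁ refl
even⊎odd (suc k) with even⊎odd k
... | inj₁ e = inj₂ (even⇒odd-suc k e)
... | inj₂ o = inj₁ (odd⇒even-suc k o)

negOnePow-square : ∀ k → negOnePow k ℤ.* negOnePow k ≡ 1ℤ
negOnePow-square k with even⊎odd k
... | inj₁ e rewrite e = refl
... | inj₂ e rewrite e = refl

fromℤ : ℤ → ℚ
fromℤ i = i ℚ./ 1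

toℚᵘ-fromℤ : ∀ i → ℚ.toℚᵘ (fromℤ i) ℚᵘ.≃ mkℚᵘ i 0
toℚᵘ-fromℤ i = ℚP.toℚᵘ-fromℚᵘ (mkℚᵘ i 0)

fromℤ-homo-+ : ∀ i j → fromℤ (i ℤ.+ j) ≡ fromℤ i ℚ.+ fromℤ j
fromℤ-homo-+ i j = ℚP.toℚᵘ-injective (begin
  ℚ.toℚᵘ (fromℤ (i ℤ.+ j))                  ≈⟨ toℚᵘ-fromℤ (i ℤ.+ j) ⟩
  mkℚᵘ (i ℤ.+ j) 0                          ≈⟨ *≡* (identity i j) ⟩
  mkℚᵘ i 0 ℚᵘ.+ mkℚᵘ j 0                    ≈⟨ ℚᵘP.+-cong (toℚᵘ-fromℤ i) (toℚᵘ-fromℤ j) ⟨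
  ℚ.toℚᵘ (fromℤ i) ℚᵘ.+ ℚ.toℚᵘ (fromℤ j)    ≈⟨ ℚP.toℚᵘ-homo-+ (fromℤ i) (fromℤ j) ⟨
  ℚ.toℚᵘ (fromℤ i ℚ.+ fromℤ j)              ∎)
  where
  open ℚᵘP.≃-Reasoning
  identity : ∀ i j → (i ℤ.+ j) ℤ.* 1ℤ ≡ (i ℤ.* 1ℤ ℤ.+ j ℤ.* 1ℤ) ℤ.* 1ℤ
  identity = solve-∀

fromℤ-homo-* : ∀ i j → fromℤ (i ℤ.* j) ≡ fromℤ i ℚ.* fromℤ j
fromℤ-homo-* i j = ℚP.toℚᵘ-injective (begin
  ℚ.toℚᵘ (fromℤ (i ℤ.* j))                  ≈⟨ toℚᵘ-fromℤ (i ℤ.* j) ⟩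
  mkℚᵘ i 0 ℚᵘ.* mkℚᵘ j 0                    ≈⟨ ℚᵘP.*-cong (toℚᵘ-fromℤ i) (toℚᵘ-fromℤ j) ⟨
  ℚ.toℚᵘ (fromℤ i) ℚᵘ.* ℚ.toℚᵘ (fromℤ j)    ≈⟨ ℚP.toℚᵘ-homo-* (fromℤ i) (fromℤ j) ⟨
  ℚ.toℚᵘ (fromℤ i ℚ.* fromℤ j)              ∎)
  where open ℚᵘP.≃-Reasoning

fromℤ-homo‿- : ∀ i → fromℤ (ℤ.- i) ≡ ℚ.- fromℤ i
fromℤ-homo‿- i = ℚP.toℚᵘ-injective (begin
  ℚ.toℚᵘ (fromℤ (ℤ.- i))      ≈⟨ toℚᵘ-fromℤ (ℤ.- i) ⟩
  ℚᵘ.- mkℚᵘ i 0               ≈⟨ ℚᵘP.-‿cong (toℚᵘ-fromℤ i) ⟨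
  ℚᵘ.- ℚ.toℚᵘ (fromℤ i)       ≈⟨ ℚP.toℚᵘ-homo‿- (fromℤ i) ⟨
  ℚ.toℚᵘ (ℚ.- fromℤ i)        ∎)
  where open ℚᵘP.≃-Reasoning

fromℤ-homo-- : ∀ i j → fromℤ (i ℤ.- j) ≡ fromℤ i ℚ.- fromℤ j
fromℤ-homo-- i j = trans (fromℤ-homo-+ i (ℤ.- j)) (cong (fromℤ i ℚ.+_) (fromℤ-homo‿- j))

fromℤ-mono-≤ : ∀ {i j} → i ℤ.≤ j → fromℤ i ℚ.≤ fromℤ j
fromℤ-mono-≤ {i} {j} i≤j = ℚP.toℚᵘ-cancel-≤
  (ℚᵘP.≤-respʳ-≃ (ℚᵘP.≃-sym (toℚᵘ-fromℤ j)) (ℚᵘP.≤-respˡ-≃ (ℚᵘP.≃-sym (toℚᵘ-fromℤ i))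
    (*≤* (ℤP.*-monoʳ-≤-nonNeg 1ℤ i≤j))))

fromℤ-*-1/ : ∀ n .{{_ : NonZero n}} → fromℤ (+ n) ℚ.* (+ 1 ℚ./ n) ≡ 1ℚ
fromℤ-*-1/ (suc d) = ℚP.toℚᵘ-injective (begin
  ℚ.toℚᵘ (fromℤ (+ suc d) ℚ.* (+ 1 ℚ./ suc d))
    ≈⟨ ℚP.toℚᵘ-homo-* (fromℤ (+ suc d)) (+ 1 ℚ./ suc d) ⟩
  ℚ.toℚᵘ (fromℤ (+ suc d)) ℚᵘ.* ℚ.toℚᵘ (+ 1 ℚ./ suc d)
    ≈⟨ ℚᵘP.*-cong (toℚᵘ-fromℤ (+ suc d)) (ℚP.toℚᵘ-fromℚᵘ (mkℚᵘ (+ 1) d)) ⟩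
  mkℚᵘ (+ suc d) 0 ℚᵘ.* mkℚᵘ (+ 1) d
    ≈⟨ *≡* (cong ℤ.+[1+_] (ℕSolver.solve (d ∷ []))) ⟩
  ℚᵘ.1ℚᵘ
    ∎)
  where open ℚᵘP.≃-Reasoning

factor : ℕ → ℕ → ℤ
factor q k = + (q ℕ.^ k) ℤ.- negOnePow k

∏factor : ℕ → ℕ → ℕ → ℤ
∏factor q c zero    = 1ℤ
∏factor q c (suc n) = factor q c ℤ.* ∏factor q (suc c) n

∑from : ℕ → ℕ → ℕ
∑from c zero    = 0
∑from c (suc n) = c ℕ.+ ∑from (suc c) n

foldr-factor-applyUpTo : ∀ q c n (f : ℕ → ℕ) → (∀ i → f i ≡ c ℕ.+ i) →
  foldr (λ k acc → factor q k ℤ.* acc) 1ℤ (applyUpTo f n) ≡ ∏factor q c n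
foldr-factor-applyUpTo q c zero    f f≗c+ = refl
foldr-factor-applyUpTo q c (suc n) f f≗c+ = cong₂ (λ k acc → factor q k ℤ.* acc)
  (trans (f≗c+ 0) (ℕP.+-identityʳ c))
  (foldr-factor-applyUpTo q (suc c) n (λ i → f (suc i)) (λ i → trans (f≗c+ (suc i)) (ℕP.+-suc c i)))

φ⁻≡∏factor : ∀ q b a → φ⁻ (b ℕ.+ 1) (b ℕ.+ a) q ≡ ∏factor q (suc b) a
φ⁻≡∏factor q b a = begin
  φ⁻ (b ℕ.+ 1) (b ℕ.+ a) q
    ≡⟨ cong (foldr _ 1ℤ) (map-applyUpTo (λ i → i) (b ℕ.+ 1 ℕ.+_) len) ⟩
  foldr _ 1ℤ (applyUpTo (b ℕ.+ 1 ℕ.+_) len)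
    ≡⟨ foldr-factor-applyUpTo q (suc b) len (b ℕ.+ 1 ℕ.+_) (λ i → cong (ℕ._+ i) b+1≡1+b) ⟩
  ∏factor q (suc b) len
    ≡⟨ cong (∏factor q (suc b)) (trans (cong (suc (b ℕ.+ a) ℕ.∸_) b+1≡1+b) (ℕP.m+n∸m≡n b a)) ⟩
  ∏factor q (suc b) a
    ∎
  where
  open ≡-Reasoning
  len : ℕ
  len = suc (b ℕ.+ a) ℕ.∸ (b ℕ.+ 1)
  b+1≡1+b : b ℕ.+ 1 ≡ 1 ℕ.+ b
  b+1≡1+b = ℕP.+-comm b 1

∑from-triangle : ∀ a b → a ℕ.* b ℕ.+ (a ℕ.+ 1) C 2 ≡ ∑from (suc b) a
∑from-triangle zero    b = refl
∑from-triangle (suc a) b = begin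
  suc a ℕ.* b ℕ.+ (suc a ℕ.+ 1) C 2           ≡⟨ cong (suc a ℕ.* b ℕ.+_) pascal ⟨
  suc a ℕ.* b ℕ.+ (a ℕ.+ 1 ℕ.+ (a ℕ.+ 1) C 2) ≡⟨ rearrange a b ((a ℕ.+ 1) C 2) ⟩
  suc b ℕ.+ (a ℕ.* suc b ℕ.+ (a ℕ.+ 1) C 2)   ≡⟨ cong (suc b ℕ.+_) (∑from-triangle a (suc b)) ⟩
  ∑from (suc b) (suc a)                        ∎
  where
  open ≡-Reasoning
  pascal : a ℕ.+ 1 ℕ.+ (a ℕ.+ 1) C 2 ≡ (suc a ℕ.+ 1) C 2
  pascal = trans (cong (ℕ._+ (a ℕ.+ 1) C 2) (sym (nC1≡n (a ℕ.+ 1)))) (nCk+nC[k+1]≡[n+1]C[k+1] (a ℕ.+ 1) 1)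
  rearrange : ∀ a b t → suc a ℕ.* b ℕ.+ (a ℕ.+ 1 ℕ.+ t) ≡ suc b ℕ.+ (a ℕ.* suc b ℕ.+ t)
  rearrange = ℕSolver.solve-∀

*-nonNeg : ∀ {i j} → 0ℤ ℤ.≤ i → 0ℤ ℤ.≤ j → 0ℤ ℤ.≤ i ℤ.* j
*-nonNeg {i} {j} 0≤i 0≤j =
  subst (ℤ._≤ i ℤ.* j) (ℤP.*-zeroʳ i) (ℤP.*-monoˡ-≤-nonNeg i {{nonNegative 0≤i}} 0≤j)

*-mono-≤-nonNeg : ∀ {i j m n} → i ℤ.≤ j → 0ℤ ℤ.≤ j → 0ℤ ℤ.≤ m → m ℤ.≤ n →
  i ℤ.* m ℤ.≤ j ℤ.* n
*-mono-≤-nonNeg {j = j} {m} i≤j 0≤j 0≤m m≤n = ℤP.≤-trans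
  (ℤP.*-monoʳ-≤-nonNeg m {{nonNegative 0≤m}} i≤j) (ℤP.*-monoˡ-≤-nonNeg j {{nonNegative 0≤j}} m≤n)

≤-by-gap : ∀ {i j d} n → d ≡ + n → j ≡ i ℤ.+ d → i ℤ.≤ j
≤-by-gap {i} n refl j≡i+n = subst (i ℤ.≤_) (sym j≡i+n) (ℤP.i≤i+j i (+ n))

x*qx≤[x+1]*[qx-1] : ∀ {q x} → 2 ≤ q → 1 ≤ x →
  + x ℤ.* (+ q ℤ.* + x) ℤ.≤ (+ x ℤ.+ 1ℤ) ℤ.* (+ q ℤ.* + x ℤ.- 1ℤ)
x*qx≤[x+1]*[qx-1] {suc (suc r)} {suc t} (s≤s (s≤s _)) (s≤s _) = ≤-by-gap (r ℕ.* suc t ℕ.+ t)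
  (sym (trans (ℤP.pos-+ (r ℕ.* suc t) t) (cong (ℤ._+ + t) (ℤP.pos-* r (suc t)))))
  (identity (+ r) (+ t))
  where
  identity : ∀ r t → (1ℤ ℤ.+ t ℤ.+ 1ℤ) ℤ.* ((+ 2 ℤ.+ r) ℤ.* (1ℤ ℤ.+ t) ℤ.- 1ℤ)
                   ≡ (1ℤ ℤ.+ t) ℤ.* ((+ 2 ℤ.+ r) ℤ.* (1ℤ ℤ.+ t)) ℤ.+ (r ℤ.* (1ℤ ℤ.+ t) ℤ.+ t)
  identity = solve-∀

[x-1]*[qx+1]≤x*qx : ∀ {q} x → 1 ≤ q →
  (+ x ℤ.- 1ℤ) ℤ.* (+ q ℤ.* + x ℤ.+ 1ℤ) ℤ.≤ + x ℤ.* (+ q ℤ.* + x)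
[x-1]*[qx+1]≤x*qx {suc r} x (s≤s _) = ≤-by-gap (suc (r ℕ.* x))
  (cong (ℤ._+_ 1ℤ) (sym (ℤP.pos-* r x))) (identity (+ r) (+ x))
  where
  identity : ∀ r x → x ℤ.* ((1ℤ ℤ.+ r) ℤ.* x)
                   ≡ (x ℤ.- 1ℤ) ℤ.* ((1ℤ ℤ.+ r) ℤ.* x ℤ.+ 1ℤ) ℤ.+ (1ℤ ℤ.+ r ℤ.* x)
  identity = solve-∀

w*[x-z]≤x*[w-1] : ∀ w x z → x ℤ.≤ w ℤ.* z → w ℤ.* (x ℤ.- z) ℤ.≤ x ℤ.* (w ℤ.- 1ℤ)
w*[x-z]≤x*[w-1] w x z x≤wz = ℤP.0≤i-j⇒j≤i
  (subst (0ℤ ℤ.≤_) (identity w x z) (ℤP.i≤j⇒0≤j-i x≤wz))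
  where
  identity : ∀ w x z → w ℤ.* z ℤ.- x ≡ x ℤ.* (w ℤ.- 1ℤ) ℤ.- w ℤ.* (x ℤ.- z)
  identity = solve-∀

pos-^-+ : ∀ q m n → + (q ℕ.^ (m ℕ.+ n)) ≡ + (q ℕ.^ m) ℤ.* + (q ℕ.^ n)
pos-^-+ q m n = trans (cong +_ (ℕP.^-distribˡ-+-* q m n)) (ℤP.pos-* (q ℕ.^ m) (q ℕ.^ n))

factor-even : ∀ q k → Even k → factor q k ≡ + (q ℕ.^ k) ℤ.- 1ℤ
factor-even q k e = cong (ℤ._-_ (+ (q ℕ.^ k))) e

factor-odd : ∀ q k → Odd k → factor q k ≡ + (q ℕ.^ k) ℤ.+ 1ℤ
factor-odd q k o = cong (ℤ._-_ (+ (q ℕ.^ k))) o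

module _ (q : ℕ) .{{_ : NonZero q}} where

  factor-nonNeg : ∀ k → 0ℤ ℤ.≤ factor q k
  factor-nonNeg k with even⊎odd k
  ... | inj₁ e rewrite e = ℤP.i≤j⇒0≤j-i (+≤+ (ℕP.m^n>0 q k))
  ... | inj₂ o rewrite o = +≤+ z≤n

  pow-pair≤factor-pair : 2 ≤ q → ∀ c → Odd c →
    + (q ℕ.^ c) ℤ.* + (q ℕ.^ suc c) ℤ.≤ factor q c ℤ.* factor q (suc c)
  pow-pair≤factor-pair 2≤q c o = subst₂ ℤ._≤_
    (cong (ℤ._*_ (+ (q ℕ.^ c))) (sym (ℤP.pos-* q (q ℕ.^ c))))
    (sym (cong₂ ℤ._*_ (factor-odd q c o)
      (trans (factor-even q (suc c) (odd⇒even-suc c o)) (cong (ℤ._- 1ℤ) (ℤP.pos-* q (q ℕ.^ c))))))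
    (x*qx≤[x+1]*[qx-1] 2≤q (ℕP.m^n>0 q c))

  pow-∑from≤∏factor : 2 ≤ q → ∀ c → Odd c → ∀ n → + (q ℕ.^ ∑from c n) ℤ.≤ ∏factor q c n
  pow-∑from≤∏factor 2≤q c o zero = ℤP.≤-refl
  pow-∑from≤∏factor 2≤q c o (suc zero) = begin
    + (q ℕ.^ (c ℕ.+ 0))   ≡⟨ cong (λ k → + (q ℕ.^ k)) (ℕP.+-identityʳ c) ⟩
    + (q ℕ.^ c)           ≤⟨ ℤP.i≤i+j (+ (q ℕ.^ c)) 1ℤ ⟩
    + (q ℕ.^ c) ℤ.+ 1ℤ    ≡⟨ factor-odd q c o ⟨
    factor q c            ≡⟨ ℤP.*-identityʳ (factor q c) ⟨
    factor q c ℤ.* 1ℤ     ∎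
    where open ℤP.≤-Reasoning
  pow-∑from≤∏factor 2≤q c o (suc (suc n)) = begin
    + (q ℕ.^ (c ℕ.+ (suc c ℕ.+ ∑from (2 ℕ.+ c) n)))
      ≡⟨ trans (pos-^-+ q c _) (cong (ℤ._*_ (+ (q ℕ.^ c))) (pos-^-+ q (suc c) _)) ⟩
    + (q ℕ.^ c) ℤ.* (+ (q ℕ.^ suc c) ℤ.* + (q ℕ.^ ∑from (2 ℕ.+ c) n))
      ≡⟨ ℤP.*-assoc (+ (q ℕ.^ c)) _ _ ⟨
    + (q ℕ.^ c) ℤ.* + (q ℕ.^ suc c) ℤ.* + (q ℕ.^ ∑from (2 ℕ.+ c) n)
      ≤⟨ *-mono-≤-nonNeg (pow-pair≤factor-pair 2≤q c o)
           (*-nonNeg (factor-nonNeg c) (factor-nonNeg (suc c))) (+≤+ z≤n)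
           (pow-∑from≤∏factor 2≤q (2 ℕ.+ c) (trans (negOnePow-suc-suc c) o) n) ⟩
    factor q c ℤ.* factor q (suc c) ℤ.* ∏factor q (2 ℕ.+ c) n
      ≡⟨ ℤP.*-assoc (factor q c) _ _ ⟩
    ∏factor q c (2 ℕ.+ n)
      ∎
    where open ℤP.≤-Reasoning

  factor-pair≤pow-pair : ∀ b → Odd b →
    factor q (suc b) ℤ.* factor q (2 ℕ.+ b) ℤ.≤ + (q ℕ.^ (3 ℕ.+ b)) ℤ.* + (q ℕ.^ b)
  factor-pair≤pow-pair b o = begin
    factor q (suc b) ℤ.* factor q (2 ℕ.+ b)
      ≡⟨ cong₂ ℤ._*_ (factor-even q (suc b) (odd⇒even-suc b o))
           (trans (factor-odd q (2 ℕ.+ b) (trans (negOnePow-suc-suc b) o))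
                  (cong (ℤ._+ 1ℤ) (ℤP.pos-* q x))) ⟩
    (+ x ℤ.- 1ℤ) ℤ.* (+ q ℤ.* + x ℤ.+ 1ℤ)
      ≤⟨ [x-1]*[qx+1]≤x*qx x (ℕ.>-nonZero⁻¹ q) ⟩
    + x ℤ.* (+ q ℤ.* + x)
      ≡⟨ trans (pos-^-+ q (suc b) (2 ℕ.+ b)) (cong (ℤ._*_ (+ x)) (ℤP.pos-* q x)) ⟨
    + (q ℕ.^ (suc b ℕ.+ (2 ℕ.+ b)))
      ≡⟨ trans (cong (λ k → + (q ℕ.^ k)) (exponent b)) (pos-^-+ q (3 ℕ.+ b) b) ⟩
    + (q ℕ.^ (3 ℕ.+ b)) ℤ.* + (q ℕ.^ b)
      ∎
    where
    open ℤP.≤-Reasoning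
    x : ℕ
    x = q ℕ.^ suc b
    exponent : ∀ b → suc b ℕ.+ (2 ℕ.+ b) ≡ 3 ℕ.+ b ℕ.+ b
    exponent = ℕSolver.solve-∀

  ∏factor-lower-bound : 2 ≤ q → ∀ b a →
    (factor q (suc b) ℤ.* factor q (2 ℕ.+ b) ℤ.- + (q ℕ.^ b)) ℤ.* + (q ℕ.^ ∑from (3 ℕ.+ b) a)
      ℤ.≤ ∏factor q (suc b) (2 ℕ.+ a)
  ∏factor-lower-bound 2≤q b = by-parity (even⊎odd b)
    where
    X z : ℤ
    X = factor q (suc b) ℤ.* factor q (2 ℕ.+ b)
    z = + (q ℕ.^ b)

    X-nonNeg : 0ℤ ℤ.≤ X
    X-nonNeg = *-nonNeg (factor-nonNeg (suc b)) (factor-nonNeg (2 ℕ.+ b))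

    from-rest-bound : ∀ {m n} → 0ℤ ℤ.≤ m → m ℤ.≤ n →
      (X ℤ.- z) ℤ.* m ℤ.≤ factor q (suc b) ℤ.* (factor q (2 ℕ.+ b) ℤ.* n)
    from-rest-bound 0≤m m≤n = ℤP.≤-trans
      (*-mono-≤-nonNeg (ℤP.i≤j⇒i-k≤j z ℤP.≤-refl) X-nonNeg 0≤m m≤n)
      (ℤP.≤-reflexive (ℤP.*-assoc (factor q (suc b)) _ _))

    by-parity : Even b ⊎ Odd b → ∀ a →
      (X ℤ.- z) ℤ.* + (q ℕ.^ ∑from (3 ℕ.+ b) a) ℤ.≤ ∏factor q (suc b) (2 ℕ.+ a)
    by-parity (inj₁ e) a = from-rest-bound (+≤+ z≤n)
      (pow-∑from≤∏factor 2≤q (3 ℕ.+ b) (even⇒odd-suc (2 ℕ.+ b) (trans (negOnePow-suc-suc b) e)) a)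
    by-parity (inj₂ o) zero = from-rest-bound (+≤+ z≤n) ℤP.≤-refl
    by-parity (inj₂ o) (suc a) = begin
      (X ℤ.- z) ℤ.* + (q ℕ.^ (3 ℕ.+ b ℕ.+ M))
        ≡⟨ cong (ℤ._*_ (X ℤ.- z)) (pos-^-+ q (3 ℕ.+ b) M) ⟩
      (X ℤ.- z) ℤ.* (w ℤ.* + (q ℕ.^ M))
        ≡⟨ trans (cong (ℤ._* + (q ℕ.^ M)) (ℤP.*-comm w (X ℤ.- z))) (ℤP.*-assoc (X ℤ.- z) w (+ (q ℕ.^ M))) ⟨
      w ℤ.* (X ℤ.- z) ℤ.* + (q ℕ.^ M)
        ≤⟨ *-mono-≤-nonNeg (w*[x-z]≤x*[w-1] w X z (factor-pair≤pow-pair b o))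
             (*-nonNeg X-nonNeg (ℤP.i≤j⇒0≤j-i (+≤+ (ℕP.m^n>0 q (3 ℕ.+ b))))) (+≤+ z≤n)
             (pow-∑from≤∏factor 2≤q (4 ℕ.+ b) (even⇒odd-suc (3 ℕ.+ b) even₃) a) ⟩
      X ℤ.* (w ℤ.- 1ℤ) ℤ.* ∏factor q (4 ℕ.+ b) a
        ≡⟨ trans (ℤP.*-assoc X (w ℤ.- 1ℤ) _)
             (cong (λ f → X ℤ.* (f ℤ.* ∏factor q (4 ℕ.+ b) a)) (sym (factor-even q (3 ℕ.+ b) even₃))) ⟩
      X ℤ.* ∏factor q (3 ℕ.+ b) (suc a)
        ≡⟨ ℤP.*-assoc (factor q (suc b)) _ _ ⟩
      ∏factor q (suc b) (2 ℕ.+ suc a)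
        ∎
      where
      open ℤP.≤-Reasoning
      M : ℕ
      M = ∑from (4 ℕ.+ b) a
      w : ℤ
      w = + (q ℕ.^ (3 ℕ.+ b))
      even₃ : Even (3 ℕ.+ b)
      even₃ = odd⇒even-suc (2 ℕ.+ b) (trans (negOnePow-suc-suc b) o)

sgn-suc : ∀ k → sgn (suc k) ≡ ℚ.- sgn k
sgn-suc k = trans (cong fromℤ (negOnePow-suc k)) (fromℤ-homo‿- (negOnePow k))

sgn-suc-suc : ∀ k → sgn (suc (suc k)) ≡ sgn k
sgn-suc-suc k = cong fromℤ (negOnePow-suc-suc k)

sgn-square : ∀ k → sgn k ℚ.* sgn k ≡ 1ℚ
sgn-square k = trans (sym (fromℤ-homo-* (negOnePow k) (negOnePow k))) (cong fromℤ (negOnePow-square k))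

qpow-+ : ∀ q m n → qpow q (m ℕ.+ n) ≡ qpow q m ℚ.* qpow q n
qpow-+ q m n = trans (cong fromℤ (pos-^-+ q m n)) (fromℤ-homo-* (+ (q ℕ.^ m)) (+ (q ℕ.^ n)))

qpow-*-qinv : ∀ q .{{_ : NonZero q}} {k} m n → k ≡ m ℕ.+ n → qpow q k ℚ.* qinv q n ≡ qpow q m
qpow-*-qinv q m n refl = begin
  qpow q (m ℕ.+ n) ℚ.* qinv q n          ≡⟨ cong (ℚ._* qinv q n) (qpow-+ q m n) ⟩
  qpow q m ℚ.* qpow q n ℚ.* qinv q n     ≡⟨ ℚP.*-assoc (qpow q m) (qpow q n) (qinv q n) ⟩
  qpow q m ℚ.* (qpow q n ℚ.* qinv q n)   ≡⟨ cong (qpow q m ℚ.*_) (fromℤ-*-1/ (q ℕ.^ n) {{ℕP.m^n≢0 q n}}) ⟩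
  qpow q m ℚ.* 1ℚ                        ≡⟨ ℚP.*-identityʳ (qpow q m) ⟩
  qpow q m                               ∎
  where open ≡-Reasoning

scaled-bracket≡fromℤ : ∀ q .{{_ : NonZero q}} b M {N} → N ≡ M ℕ.+ (suc b ℕ.+ (2 ℕ.+ b)) →
  qpow q N
    ℚ.* (1ℚ ℚ.+ sgn b ℚ.* qinv q (b ℕ.+ 1) ℚ.- sgn b ℚ.* qinv q (b ℕ.+ 2)
            ℚ.- qinv q (b ℕ.+ 3) ℚ.- qinv q (2 ℕ.* b ℕ.+ 3))
  ≡ fromℤ ((factor q (suc b) ℤ.* factor q (2 ℕ.+ b) ℤ.- + (q ℕ.^ b)) ℤ.* + (q ℕ.^ M))
scaled-bracket≡fromℤ q b M refl = begin
  qpow q (M ℕ.+ K) ℚ.* (1ℚ ℚ.+ s ℚ.* J₁ ℚ.- s ℚ.* J₂ ℚ.- J₃ ℚ.- J₄)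
    ≡⟨ cong (ℚ._* (1ℚ ℚ.+ s ℚ.* J₁ ℚ.- s ℚ.* J₂ ℚ.- J₃ ℚ.- J₄)) (qpow-+ q M K) ⟩
  B ℚ.* A ℚ.* (1ℚ ℚ.+ s ℚ.* J₁ ℚ.- s ℚ.* J₂ ℚ.- J₃ ℚ.- J₄)
    ≡⟨ distribute B A s J₁ J₂ J₃ J₄ ⟩
  B ℚ.* (A ℚ.+ s ℚ.* (A ℚ.* J₁) ℚ.- s ℚ.* (A ℚ.* J₂) ℚ.- A ℚ.* J₃ ℚ.- A ℚ.* J₄)
    ≡⟨ cong (B ℚ.*_) (cong₂ ℚ._-_ (cong₂ ℚ._-_ (cong₂ ℚ._-_ (cong₂ ℚ._+_
         (qpow-+ q (suc b) (2 ℕ.+ b)) (cong (s ℚ.*_) (qpow-*-qinv q (2 ℕ.+ b) (b ℕ.+ 1) (K≡₁ b))))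
         (cong (s ℚ.*_) (qpow-*-qinv q (suc b) (b ℕ.+ 2) (K≡₂ b)))) (qpow-*-qinv q b (b ℕ.+ 3) (K≡₃ b)))
         (trans (qpow-*-qinv q 0 (2 ℕ.* b ℕ.+ 3) (K≡₄ b)) (sym (sgn-square b)))) ⟩
  B ℚ.* (Z₁ ℚ.* Z₂ ℚ.+ s ℚ.* Z₂ ℚ.- s ℚ.* Z₁ ℚ.- Z ℚ.- s ℚ.* s)
    ≡⟨ factorise B Z₁ Z₂ Z s ⟩
  ((Z₁ ℚ.- ℚ.- s) ℚ.* (Z₂ ℚ.- s) ℚ.- Z) ℚ.* B
    ≡⟨ fromℤ-numerator ⟨
  fromℤ ((f₁ ℤ.* f₂ ℤ.- + (q ℕ.^ b)) ℤ.* + (q ℕ.^ M))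
    ∎
  where
  open ≡-Reasoning
  open +-*-Solver
  K : ℕ
  K = suc b ℕ.+ (2 ℕ.+ b)
  f₁ f₂ : ℤ
  f₁ = factor q (suc b)
  f₂ = factor q (2 ℕ.+ b)
  s A B Z Z₁ Z₂ J₁ J₂ J₃ J₄ : ℚ
  s = sgn b
  A = qpow q K
  B = qpow q M
  Z = qpow q b
  Z₁ = qpow q (suc b)
  Z₂ = qpow q (2 ℕ.+ b)
  J₁ = qinv q (b ℕ.+ 1)
  J₂ = qinv q (b ℕ.+ 2)
  J₃ = qinv q (b ℕ.+ 3)
  J₄ = qinv q (2 ℕ.* b ℕ.+ 3)

  K≡₁ : ∀ n → suc n ℕ.+ (2 ℕ.+ n) ≡ 2 ℕ.+ n ℕ.+ (n ℕ.+ 1)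
  K≡₁ = ℕSolver.solve-∀
  K≡₂ : ∀ n → suc n ℕ.+ (2 ℕ.+ n) ≡ suc n ℕ.+ (n ℕ.+ 2)
  K≡₂ = ℕSolver.solve-∀
  K≡₃ : ∀ n → suc n ℕ.+ (2 ℕ.+ n) ≡ n ℕ.+ (n ℕ.+ 3)
  K≡₃ = ℕSolver.solve-∀
  K≡₄ : ∀ n → suc n ℕ.+ (2 ℕ.+ n) ≡ 0 ℕ.+ (2 ℕ.* n ℕ.+ 3)
  K≡₄ = ℕSolver.solve-∀

  distribute : ∀ B A s J₁ J₂ J₃ J₄ →
    B ℚ.* A ℚ.* (1ℚ ℚ.+ s ℚ.* J₁ ℚ.- s ℚ.* J₂ ℚ.- J₃ ℚ.- J₄)
    ≡ B ℚ.* (A ℚ.+ s ℚ.* (A ℚ.* J₁) ℚ.- s ℚ.* (A ℚ.* J₂) ℚ.- A ℚ.* J₃ ℚ.- A ℚ.* J₄)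
  distribute = solve 7 (λ B A s J₁ J₂ J₃ J₄ →
    B :* A :* (con 1ℚ :+ s :* J₁ :- s :* J₂ :- J₃ :- J₄)
    := B :* (A :+ s :* (A :* J₁) :- s :* (A :* J₂) :- A :* J₃ :- A :* J₄)) refl

  factorise : ∀ B Z₁ Z₂ Z s →
    B ℚ.* (Z₁ ℚ.* Z₂ ℚ.+ s ℚ.* Z₂ ℚ.- s ℚ.* Z₁ ℚ.- Z ℚ.- s ℚ.* s)
    ≡ ((Z₁ ℚ.- ℚ.- s) ℚ.* (Z₂ ℚ.- s) ℚ.- Z) ℚ.* B
  factorise = solve 5 (λ B Z₁ Z₂ Z s →
    B :* (Z₁ :* Z₂ :+ s :* Z₂ :- s :* Z₁ :- Z :- s :* s)
    := ((Z₁ :- :- s) :* (Z₂ :- s) :- Z) :* B) refl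

  fromℤ-numerator : fromℤ ((f₁ ℤ.* f₂ ℤ.- + (q ℕ.^ b)) ℤ.* + (q ℕ.^ M))
                    ≡ ((Z₁ ℚ.- ℚ.- s) ℚ.* (Z₂ ℚ.- s) ℚ.- Z) ℚ.* B
  fromℤ-numerator = begin
    fromℤ ((f₁ ℤ.* f₂ ℤ.- + (q ℕ.^ b)) ℤ.* + (q ℕ.^ M))
      ≡⟨ fromℤ-homo-* (f₁ ℤ.* f₂ ℤ.- + (q ℕ.^ b)) (+ (q ℕ.^ M)) ⟩
    fromℤ (f₁ ℤ.* f₂ ℤ.- + (q ℕ.^ b)) ℚ.* B
      ≡⟨ cong (ℚ._* B) (fromℤ-homo-- (f₁ ℤ.* f₂) (+ (q ℕ.^ b))) ⟩
    (fromℤ (f₁ ℤ.* f₂) ℚ.- Z) ℚ.* B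
      ≡⟨ cong (λ t → (t ℚ.- Z) ℚ.* B) (trans (fromℤ-homo-* f₁ f₂) (cong₂ ℚ._*_ F₁≡ F₂≡)) ⟩
    ((Z₁ ℚ.- ℚ.- s) ℚ.* (Z₂ ℚ.- s) ℚ.- Z) ℚ.* B
      ∎
    where
    F₁≡ : fromℤ f₁ ≡ Z₁ ℚ.- ℚ.- s
    F₁≡ = trans (fromℤ-homo-- (+ (q ℕ.^ suc b)) (negOnePow (suc b))) (cong (ℚ._-_ Z₁) (sgn-suc b))
    F₂≡ : fromℤ f₂ ≡ Z₂ ℚ.- s
    F₂≡ = trans (fromℤ-homo-- (+ (q ℕ.^ (2 ℕ.+ b))) (negOnePow (2 ℕ.+ b))) (cong (ℚ._-_ Z₂) (sgn-suc-suc b))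

isPrimePower⇒2≤ : ∀ {q} → IsPrimePower q → 2 ≤ q
isPrimePower⇒2≤ (p , k , p-prime , 1≤k , refl) = ℕP.≤-trans (ℕ.nonTrivial⇒n>1 p {{prime⇒nonTrivial p-prime}})
  (ℕP.≤-trans (ℕP.≤-reflexive (sym (ℕP.^-identityʳ p))) (ℕP.^-monoʳ-≤ p {{prime⇒nonZero p-prime}} 1≤k))

lemma2p12 : (q : ℕ) .{{_ : NonZero q}} → IsPrimePower q → (a b : ℕ) → 2 ≤ a →
    qpow q (a ℕ.* b ℕ.+ ((a ℕ.+ 1) C 2))
      ℚ.* (ℚ.1ℚ ℚ.+ sgn b ℚ.* qinv q (b ℕ.+ 1) ℚ.- sgn b ℚ.* qinv q (b ℕ.+ 2)
                ℚ.- qinv q (b ℕ.+ 3) ℚ.- qinv q (2 ℕ.* b ℕ.+ 3))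
      ℚ.≤ (φ⁻ (b ℕ.+ 1) (b ℕ.+ a) q ℚ./ 1)
lemma2p12 q q-primePower (suc (suc a)) b (s≤s (s≤s _)) = subst₂ ℚ._≤_
  (sym (scaled-bracket≡fromℤ q b (∑from (3 ℕ.+ b) a) exponent))
  (cong fromℤ (sym (φ⁻≡∏factor q b (2 ℕ.+ a))))
  (fromℤ-mono-≤ (∏factor-lower-bound q (isPrimePower⇒2≤ q-primePower) b a))
  where
  rearrange : ∀ b m → suc b ℕ.+ (2 ℕ.+ b ℕ.+ m) ≡ m ℕ.+ (suc b ℕ.+ (2 ℕ.+ b))
  rearrange = ℕSolver.solve-∀
  exponent : (2 ℕ.+ a) ℕ.* b ℕ.+ (2 ℕ.+ a ℕ.+ 1) C 2 ≡ ∑from (3 ℕ.+ b) a ℕ.+ (suc b ℕ.+ (2 ℕ.+ b))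
  exponent = trans (∑from-triangle (2 ℕ.+ a) b) (rearrange b (∑from (3 ℕ.+ b) a))
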